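{- Let $\varepsilon\in\{1,-1\}$. Let $X,Y,Z\in\mathbb{Z}[i]$ with $X,Z\in O^I$ and $Y=(1+i)W$, where $W$ is a product of (not necessarily distinct) Gaussian primes belonging to $O^I$, and suppose $X^2+Z^2=\varepsilon iY^2$, $\gcd(X,Y,Z)\in U$ and $XYZ\neq0$. Then there exist an integer $t$ with $0\le t\le 3$ and $P,Q\in\mathbb{Z}[i]$, each a product of powers of distinct Gaussian primes belonging to $O^I$, with $\gcd(P,Q)=1$, such that $$X=i^{t+1}\,\frac{P^2+\varepsilon(-1)^t iQ^2}{1+i},\quad Z=i^{t}\,\frac{P^2-\varepsilon(-1)^t iQ^2}{1+i},\quad Y=(1+i)PQ.$$
   Context: $\mathbb{Z}[i]$ is the ring of Gaussian integers and $U=\{1,-1,i,-i\}$ its unit group. For $\alpha\in\mathbb{Z}[i]$, $R(\alpha)$ and $I(\alpha)$ denote its real and imaginary parts. $O^I=\{\alpha\in\mathbb{Z}[i]: R(\alpha)+I(\alpha)\equiv 1 \pmod 2,\ R(\alpha)\equiv 1 \pmod 4\}$. "$\gcd(\cdot)=1$" or "$\in U$" means no common non-unit divisor. -}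

module Defs where

open import Data.Nat using (ℕ; zero; suc)
open import Data.Integer as ℤ using (ℤ; +_; -[1+_])
import Data.Integer.Divisibility as ℤD
open import Data.Product using (Σ; ∃; _×_; _,_; proj₁)
open import Data.Sum using (_⊎_)
open import Data.List using (List; []; _∷_; map)
open import Data.List.Relation.Unary.All using (All)
open import Data.List.Relation.Unary.AllPairs using (AllPairs)
open import Relation.Binary.PropositionalEquality using (_≡_; _≢_)
open import Relation.Nullary using (¬_)

record ℤ[i] : Set where
  constructor _+_i
  field
    re : ℤ
    im : ℤ
open ℤ[i] public

infixl 6 _⊕_
infixl 7 _⊗_
infixr 8 _^_

_⊕_ : ℤ[i] → ℤ[i] → ℤ[i]
(a + b i) ⊕ (c + d i) = (a ℤ.+ c) + (b ℤ.+ d) i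

_⊗_ : ℤ[i] → ℤ[i] → ℤ[i]
(a + b i) ⊗ (c + d i) = ((a ℤ.* c) ℤ.- (b ℤ.* d)) + ((a ℤ.* d) ℤ.+ (b ℤ.* c)) i

⊖_ : ℤ[i] → ℤ[i]
⊖ (a + b i) = (ℤ.- a) + (ℤ.- b) i

𝟘 𝟙 𝕚 : ℤ[i]
𝟘 = (+ 0) + (+ 0) i
𝟙 = (+ 1) + (+ 0) i
𝕚 = (+ 0) + (+ 1) i

_^_ : ℤ[i] → ℕ → ℤ[i]
x ^ zero = 𝟙
x ^ suc n = x ⊗ (x ^ n)

_∣_ : ℤ[i] → ℤ[i] → Set
α ∣ β = ∃ λ γ → β ≡ α ⊗ γ

IsUnit : ℤ[i] → Set
IsUnit u = u ≡ 𝟙 ⊎ u ≡ ⊖ 𝟙 ⊎ u ≡ 𝕚 ⊎ u ≡ ⊖ 𝕚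

GaussianPrime : ℤ[i] → Set
GaussianPrime π = π ≢ 𝟘 × ¬ IsUnit π × (∀ α β → π ∣ (α ⊗ β) → π ∣ α ⊎ π ∣ β)

OI : ℤ[i] → Set
OI α = (+ 2) ℤD.∣ ((re α ℤ.+ im α) ℤ.- + 1) × (+ 4) ℤD.∣ (re α ℤ.- + 1)

prod : List ℤ[i] → ℤ[i]
prod [] = 𝟙
prod (x ∷ xs) = x ⊗ prod xs

OIPrime : ℤ[i] → Set
OIPrime π = GaussianPrime π × OI π

ProdOfOIPrimes : ℤ[i] → Set
ProdOfOIPrimes α = Σ (List ℤ[i]) λ ps → All OIPrime ps × α ≡ prod ps

ProdOfPowersOfDistinctOIPrimes : ℤ[i] → Set
ProdOfPowersOfDistinctOIPrimes α =
  Σ (List (ℤ[i] × ℕ)) λ pes →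
    All (λ pe → OIPrime (proj₁ pe)) pes
    × AllPairs _≢_ (map proj₁ pes)
    × α ≡ prod (map (λ { (p , e) → p ^ e }) pes)

CoprimeTo3 : ℤ[i] → ℤ[i] → ℤ[i] → Set
CoprimeTo3 x y z = ∀ d → d ∣ x → d ∣ y → d ∣ z → IsUnit d

Coprime : ℤ[i] → ℤ[i] → Set
Coprime x y = ∀ d → d ∣ x → d ∣ y → IsUnit d

1+i : ℤ[i]
1+i = (+ 1) + (+ 1) i

-- Write X = 1 + 2U and Z = 1 + 2V. Then A = (Z - iX)/(1 - i) and B = (X - iZ)/(1 - i) are
-- Gaussian integers with (1 + i)X = iA + B, (1 + i)Z = A + iB and 2AB = X² + Z² = -2εW².
-- A common divisor of A and B divides 2X and 2Z, hence X and Z if it divides an odd element;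
-- so no prime of W (an odd prime dividing Y) divides both A and B. Distributing the primes
-- of W between A and B gives A = αP², B = βQ² with PQ = W and αβ = -ε; writing the unit α
-- as iᵗ and substituting into the expressions for (1 + i)X and (1 + i)Z gives the result.
module Submission where

open import Defs
open import Data.Nat using (ℕ; suc; _≤_)
open import Data.Product using (Σ; ∃; _×_; _,_)
open import Data.Sum using (_⊎_)
open import Relation.Binary.PropositionalEquality using (_≡_; _≢_)

import Data.Nat as ℕ
open import Data.Nat using (zero; z≤n; s≤s)
import Data.Nat.Properties as ℕₚ
open import Data.Integer using (ℤ; +_; -[1+_])
import Data.Integer as Int
import Data.Integer.Properties as ℤₚ
import Data.Integer.Divisibility.Signed as ℤ∣
import Data.Integer.Tactic.RingSolver as ℤ-Solver
open import Data.Product using (proj₁; proj₂)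
open import Data.Sum using (inj₁; inj₂; [_,_])
import Data.Sum as Sum
open import Data.Maybe using (Maybe; just; nothing)
open import Data.Empty using (⊥-elim)
open import Function using (_∘_)
open import Data.List using (List; []; _∷_; map)
open import Data.List.Relation.Unary.All as All using (All; []; _∷_)
import Data.List.Relation.Unary.All.Properties as All
open import Data.List.Relation.Unary.AllPairs using (AllPairs; []; _∷_)
open import Data.List.Relation.Ternary.Interleaving.Propositional
  using (Interleaving; []; consˡ; consʳ; swap)
open import Relation.Binary.PropositionalEquality
  using (refl; sym; trans; cong; cong₂; subst; isEquivalence; module ≡-Reasoning)
open import Relation.Nullary using (yes; no; ¬_; Dec)
open import Algebra.Structures {A = ℤ[i]} _≡_ using (IsCommutativeRing)
open import Algebra.Bundles using (CommutativeRing)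
import Tactic.RingSolver.Core.AlmostCommutativeRing as ACR
open import Tactic.RingSolver using (solve-∀)
open import Level using (0ℓ)

⊕-assoc : ∀ x y z → x ⊕ y ⊕ z ≡ x ⊕ (y ⊕ z)
⊕-assoc (a + b i) (c + d i) (e + f i) = cong₂ _+_i (ℤₚ.+-assoc a c e) (ℤₚ.+-assoc b d f)

⊕-comm : ∀ x y → x ⊕ y ≡ y ⊕ x
⊕-comm (a + b i) (c + d i) = cong₂ _+_i (ℤₚ.+-comm a c) (ℤₚ.+-comm b d)

⊕-identityˡ : ∀ x → 𝟘 ⊕ x ≡ x
⊕-identityˡ (a + b i) = cong₂ _+_i (ℤₚ.+-identityˡ a) (ℤₚ.+-identityˡ b)

⊕-identityʳ : ∀ x → x ⊕ 𝟘 ≡ x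
⊕-identityʳ (a + b i) = cong₂ _+_i (ℤₚ.+-identityʳ a) (ℤₚ.+-identityʳ b)

⊖-inverseˡ : ∀ x → ⊖ x ⊕ x ≡ 𝟘
⊖-inverseˡ (a + b i) = cong₂ _+_i (ℤₚ.+-inverseˡ a) (ℤₚ.+-inverseˡ b)

⊖-inverseʳ : ∀ x → x ⊕ ⊖ x ≡ 𝟘
⊖-inverseʳ (a + b i) = cong₂ _+_i (ℤₚ.+-inverseʳ a) (ℤₚ.+-inverseʳ b)

module _ where
  open Int using (_+_; _*_; _-_)

  ⊗-assoc : ∀ x y z → x ⊗ y ⊗ z ≡ x ⊗ (y ⊗ z)
  ⊗-assoc (a + b i) (c + d i) (e + f i) = cong₂ _+_i (re-assoc a b c d e f) (im-assoc a b c d e f)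
    where
    re-assoc : ∀ a b c d e f →
      (a * c - b * d) * e - (a * d + b * c) * f ≡ a * (c * e - d * f) - b * (c * f + d * e)
    re-assoc = ℤ-Solver.solve-∀
    im-assoc : ∀ a b c d e f →
      (a * c - b * d) * f + (a * d + b * c) * e ≡ a * (c * f + d * e) + b * (c * e - d * f)
    im-assoc = ℤ-Solver.solve-∀

  ⊗-comm : ∀ x y → x ⊗ y ≡ y ⊗ x
  ⊗-comm (a + b i) (c + d i) = cong₂ _+_i (re-comm a b c d) (im-comm a b c d)
    where
    re-comm : ∀ a b c d → a * c - b * d ≡ c * a - d * b
    re-comm = ℤ-Solver.solve-∀
    im-comm : ∀ a b c d → a * d + b * c ≡ c * b + d * a
    im-comm = ℤ-Solver.solve-∀

  ⊗-identityˡ : ∀ x → 𝟙 ⊗ x ≡ x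
  ⊗-identityˡ (a + b i) = cong₂ _+_i (re-identity a b) (im-identity a b)
    where
    re-identity : ∀ a b → + 1 * a - + 0 * b ≡ a
    re-identity = ℤ-Solver.solve-∀
    im-identity : ∀ a b → + 1 * b + + 0 * a ≡ b
    im-identity = ℤ-Solver.solve-∀

  ⊗-distribˡ-⊕ : ∀ x y z → x ⊗ (y ⊕ z) ≡ x ⊗ y ⊕ x ⊗ z
  ⊗-distribˡ-⊕ (a + b i) (c + d i) (e + f i) = cong₂ _+_i (re-distrib a b c d e f) (im-distrib a b c d e f)
    where
    re-distrib : ∀ a b c d e f → a * (c + e) - b * (d + f) ≡ (a * c - b * d) + (a * e - b * f)
    re-distrib = ℤ-Solver.solve-∀
    im-distrib : ∀ a b c d e f → a * (d + f) + b * (c + e) ≡ (a * d + b * c) + (a * f + b * e)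
    im-distrib = ℤ-Solver.solve-∀

⊗-identityʳ : ∀ x → x ⊗ 𝟙 ≡ x
⊗-identityʳ x = trans (⊗-comm x 𝟙) (⊗-identityˡ x)

⊗-distribʳ-⊕ : ∀ x y z → (y ⊕ z) ⊗ x ≡ y ⊗ x ⊕ z ⊗ x
⊗-distribʳ-⊕ x y z = trans (⊗-comm (y ⊕ z) x) (trans (⊗-distribˡ-⊕ x y z) (cong₂ _⊕_ (⊗-comm x y) (⊗-comm x z)))

ℤ[i]-isCommutativeRing : IsCommutativeRing _⊕_ _⊗_ ⊖_ 𝟘 𝟙
ℤ[i]-isCommutativeRing = record
  { isRing = record
    { +-isAbelianGroup = record
      { isGroup = record
        { isMonoid = record
          { isSemigroup = record
            { isMagma = record { isEquivalence = isEquivalence ; ∙-cong = cong₂ _⊕_ }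
            ; assoc = ⊕-assoc }
          ; identity = ⊕-identityˡ , ⊕-identityʳ }
        ; inverse = ⊖-inverseˡ , ⊖-inverseʳ
        ; ⁻¹-cong = cong ⊖_ }
      ; comm = ⊕-comm }
    ; *-cong = cong₂ _⊗_
    ; *-assoc = ⊗-assoc
    ; *-identity = ⊗-identityˡ , ⊗-identityʳ
    ; distrib = ⊗-distribˡ-⊕ , ⊗-distribʳ-⊕ }
  ; *-comm = ⊗-comm }

ℤ[i]-commutativeRing : CommutativeRing 0ℓ 0ℓ
ℤ[i]-commutativeRing = record { isCommutativeRing = ℤ[i]-isCommutativeRing }

ℤ[i]-ring : ACR.AlmostCommutativeRing 0ℓ 0ℓ
ℤ[i]-ring = ACR.fromCommutativeRing ℤ[i]-commutativeRing is𝟘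
  where
  is𝟘 : ∀ x → Maybe (𝟘 ≡ x)
  is𝟘 ((+ 0) + (+ 0) i) = just refl
  is𝟘 _ = nothing

⊗-left-comm : ∀ x y z → x ⊗ (y ⊗ z) ≡ y ⊗ (x ⊗ z)
⊗-left-comm = solve-∀ ℤ[i]-ring

∣-refl : ∀ x → x ∣ x
∣-refl x = 𝟙 , sym (⊗-identityʳ x)

∣x⇒∣x⊗y : ∀ {d x} y → d ∣ x → d ∣ (x ⊗ y)
∣x⇒∣x⊗y {d} y (u , refl) = u ⊗ y , ⊗-assoc d u y

∣y⇒∣x⊗y : ∀ {d y} x → d ∣ y → d ∣ (x ⊗ y)
∣y⇒∣x⊗y {d} {y} x d∣y = subst (d ∣_) (⊗-comm y x) (∣x⇒∣x⊗y {d} x d∣y)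

∣x∣y⇒∣x⊕y : ∀ {d x y} → d ∣ x → d ∣ y → d ∣ (x ⊕ y)
∣x∣y⇒∣x⊕y {d} (u , refl) (v , refl) = u ⊕ v , sym (⊗-distribˡ-⊕ d u v)

norm : ℤ[i] → ℕ
norm (a + b i) = Int.∣ a ∣ ℕ.* Int.∣ a ∣ ℕ.+ Int.∣ b ∣ ℕ.* Int.∣ b ∣

+norm : ∀ x → + norm x ≡ re x Int.* re x Int.+ im x Int.* im x
+norm (a + b i) = begin
  + (∣a∣² ℕ.+ ∣b∣²)      ≡⟨ ℤₚ.pos-+ ∣a∣² ∣b∣² ⟩
  + ∣a∣² Int.+ + ∣b∣²    ≡⟨ cong₂ Int._+_ (square a) (square b) ⟩
  a Int.* a Int.+ b Int.* b ∎
  where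
  open ≡-Reasoning
  ∣a∣² ∣b∣² : ℕ
  ∣a∣² = Int.∣ a ∣ ℕ.* Int.∣ a ∣
  ∣b∣² = Int.∣ b ∣ ℕ.* Int.∣ b ∣
  square : ∀ c → + (Int.∣ c ∣ ℕ.* Int.∣ c ∣) ≡ c Int.* c
  square (+ zero) = refl
  square (+ suc n) = refl
  square -[1+ n ] = refl

norm-⊗ : ∀ x y → norm (x ⊗ y) ≡ norm x ℕ.* norm y
norm-⊗ x@(a + b i) y@(c + d i) = ℤₚ.+-injective (begin
  + norm (x ⊗ y)                          ≡⟨ +norm (x ⊗ y) ⟩
  (a * c - b * d) * (a * c - b * d) + (a * d + b * c) * (a * d + b * c)
                                          ≡⟨ brahmagupta a b c d ⟩
  (a * a + b * b) * (c * c + d * d)       ≡⟨ sym (cong₂ _*_ (+norm x) (+norm y)) ⟩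
  + norm x * + norm y                     ≡⟨ ℤₚ.pos-* (norm x) (norm y) ⟨
  + (norm x ℕ.* norm y)                   ∎)
  where
  open ≡-Reasoning
  open Int using (_+_; _*_; _-_)
  brahmagupta : ∀ a b c d → (a * c - b * d) * (a * c - b * d) + (a * d + b * c) * (a * d + b * c)
                            ≡ (a * a + b * b) * (c * c + d * d)
  brahmagupta = ℤ-Solver.solve-∀

norm≡0⇒≡𝟘 : ∀ x → norm x ≡ 0 → x ≡ 𝟘
norm≡0⇒≡𝟘 (a + b i) n≡0 = cong₂ _+_i (square≡0 a (ℕₚ.m+n≡0⇒m≡0 _ n≡0)) (square≡0 b (ℕₚ.m+n≡0⇒n≡0 _ n≡0))
  where
  square≡0 : ∀ c → Int.∣ c ∣ ℕ.* Int.∣ c ∣ ≡ 0 → c ≡ + 0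
  square≡0 (+ zero) _ = refl

x⊗y≡𝟘⇒x≡𝟘∨y≡𝟘 : ∀ x y → x ⊗ y ≡ 𝟘 → x ≡ 𝟘 ⊎ y ≡ 𝟘
x⊗y≡𝟘⇒x≡𝟘∨y≡𝟘 x y xy≡𝟘 = Sum.map (norm≡0⇒≡𝟘 x) (norm≡0⇒≡𝟘 y)
  (ℕₚ.m*n≡0⇒m≡0∨n≡0 (norm x) (trans (sym (norm-⊗ x y)) (cong norm xy≡𝟘)))

⊗-cancelˡ : ∀ x {y z} → x ≢ 𝟘 → x ⊗ y ≡ x ⊗ z → y ≡ z
⊗-cancelˡ x {y} {z} x≢𝟘 xy≡xz = [ ⊥-elim ∘ x≢𝟘 , y-z≡𝟘⇒y≡z ]
  (x⊗y≡𝟘⇒x≡𝟘∨y≡𝟘 x (y ⊕ ⊖ z) x⊗[y-z]≡𝟘)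
  where
  open ≡-Reasoning
  x⊗[y-z]≡𝟘 : x ⊗ (y ⊕ ⊖ z) ≡ 𝟘
  x⊗[y-z]≡𝟘 = begin
    x ⊗ (y ⊕ ⊖ z)         ≡⟨ ⊗-distribˡ-⊖ x y z ⟩
    x ⊗ y ⊕ ⊖ (x ⊗ z)     ≡⟨ cong (_⊕ ⊖ (x ⊗ z)) xy≡xz ⟩
    x ⊗ z ⊕ ⊖ (x ⊗ z)     ≡⟨ ⊖-inverseʳ (x ⊗ z) ⟩
    𝟘                     ∎
    where
    ⊗-distribˡ-⊖ : ∀ x y z → x ⊗ (y ⊕ ⊖ z) ≡ x ⊗ y ⊕ ⊖ (x ⊗ z)
    ⊗-distribˡ-⊖ = solve-∀ ℤ[i]-ring
  y-z≡𝟘⇒y≡z : y ⊕ ⊖ z ≡ 𝟘 → y ≡ z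
  y-z≡𝟘⇒y≡z y-z≡𝟘 = begin
    y               ≡⟨ ⊖-⊕-cancel y z ⟩
    y ⊕ ⊖ z ⊕ z     ≡⟨ cong (_⊕ z) y-z≡𝟘 ⟩
    𝟘 ⊕ z           ≡⟨ ⊕-identityˡ z ⟩
    z               ∎
    where
    ⊖-⊕-cancel : ∀ y z → y ≡ y ⊕ ⊖ z ⊕ z
    ⊖-⊕-cancel = solve-∀ ℤ[i]-ring

norm≡1⇒IsUnit : ∀ x → norm x ≡ 1 → IsUnit x
norm≡1⇒IsUnit ((+ 1) + (+ 0) i) _ = inj₁ refl
norm≡1⇒IsUnit (-[1+ 0 ] + (+ 0) i) _ = inj₂ (inj₁ refl)
norm≡1⇒IsUnit ((+ 0) + (+ 1) i) _ = inj₂ (inj₂ (inj₁ refl))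
norm≡1⇒IsUnit ((+ 0) + -[1+ 0 ] i) _ = inj₂ (inj₂ (inj₂ refl))
norm≡1⇒IsUnit ((+ 0) + (+ 0) i) ()
norm≡1⇒IsUnit ((+ 0) + (+ suc (suc _)) i) ()
norm≡1⇒IsUnit ((+ 0) + -[1+ suc _ ] i) ()
norm≡1⇒IsUnit ((+ 1) + (+ suc _) i) ()
norm≡1⇒IsUnit ((+ 1) + -[1+ _ ] i) ()
norm≡1⇒IsUnit ((+ suc (suc _)) + _ i) ()
norm≡1⇒IsUnit (-[1+ 0 ] + (+ suc _) i) ()
norm≡1⇒IsUnit (-[1+ 0 ] + -[1+ _ ] i) ()
norm≡1⇒IsUnit (-[1+ suc _ ] + _ i) ()

IsUnit⇒norm≡1 : ∀ {u} → IsUnit u → norm u ≡ 1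
IsUnit⇒norm≡1 (inj₁ refl) = refl
IsUnit⇒norm≡1 (inj₂ (inj₁ refl)) = refl
IsUnit⇒norm≡1 (inj₂ (inj₂ (inj₁ refl))) = refl
IsUnit⇒norm≡1 (inj₂ (inj₂ (inj₂ refl))) = refl

IsUnit-⊖ : ∀ {u} → IsUnit u → IsUnit (⊖ u)
IsUnit-⊖ (inj₁ refl) = inj₂ (inj₁ refl)
IsUnit-⊖ (inj₂ (inj₁ refl)) = inj₁ refl
IsUnit-⊖ (inj₂ (inj₂ (inj₁ refl))) = inj₂ (inj₂ (inj₂ refl))
IsUnit-⊖ (inj₂ (inj₂ (inj₂ refl))) = inj₂ (inj₂ (inj₁ refl))

IsUnit-factor : ∀ {x y u} → x ⊗ y ≡ u → IsUnit u → IsUnit x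
IsUnit-factor {x} {y} refl unit =
  norm≡1⇒IsUnit x (ℕₚ.m*n≡1⇒m≡1 (norm x) (norm y) (trans (sym (norm-⊗ x y)) (IsUnit⇒norm≡1 unit)))

IsUnit⇒≡𝕚^ : ∀ {u} → IsUnit u → Σ ℕ λ t → t ≤ 3 × u ≡ 𝕚 ^ t
IsUnit⇒≡𝕚^ (inj₁ refl) = 0 , z≤n , refl
IsUnit⇒≡𝕚^ (inj₂ (inj₁ refl)) = 2 , s≤s (s≤s z≤n) , refl
IsUnit⇒≡𝕚^ (inj₂ (inj₂ (inj₁ refl))) = 1 , s≤s z≤n , refl
IsUnit⇒≡𝕚^ (inj₂ (inj₂ (inj₂ refl))) = 3 , s≤s (s≤s (s≤s z≤n)) , refl

𝕚^n⊗𝕚^n⊗[-1]^n≡𝟙 : ∀ n → 𝕚 ^ n ⊗ 𝕚 ^ n ⊗ (⊖ 𝟙) ^ n ≡ 𝟙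
𝕚^n⊗𝕚^n⊗[-1]^n≡𝟙 zero = refl
𝕚^n⊗𝕚^n⊗[-1]^n≡𝟙 (suc n) =
  trans (regroup (𝕚 ^ n) ((⊖ 𝟙) ^ n)) (𝕚^n⊗𝕚^n⊗[-1]^n≡𝟙 n)
  where
  regroup : ∀ a m → 𝕚 ⊗ a ⊗ (𝕚 ⊗ a) ⊗ (⊖ 𝟙 ⊗ m) ≡ a ⊗ a ⊗ m
  regroup = solve-∀ ℤ[i]-ring

𝟚 : ℤ[i]
𝟚 = (+ 2) + (+ 0) i

Odd : ℤ[i] → Set
Odd x = ∃ λ u → x ≡ 𝟙 ⊕ 𝟚 ⊗ u

OI⇒Odd : ∀ {x} → OI x → Odd x
OI⇒Odd {r + s i} (2∣r+s-1 , 4∣r-1)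
  with ℤ∣.divides p r+s-1≡p*2 ← ℤ∣.∣ᵤ⇒∣ {+ 2} {r Int.+ s Int.- + 1} 2∣r+s-1
     | ℤ∣.divides q r-1≡q*4 ← ℤ∣.∣ᵤ⇒∣ {+ 4} {r Int.- + 1} 4∣r-1
  = (q Int.* + 2) + (p Int.- q Int.* + 2) i , cong₂ _+_i r≡ s≡
  where
  open Int using (_+_; _*_; _-_)
  open ≡-Reasoning
  re-form : ∀ r → r ≡ (r - + 1) + + 1
  re-form = ℤ-Solver.solve-∀
  re-odd : ∀ p q → q * + 4 + + 1 ≡ + 1 + (+ 2 * (q * + 2) - + 0 * (p - q * + 2))
  re-odd = ℤ-Solver.solve-∀
  im-form : ∀ r s → s ≡ (r + s - + 1) - (r - + 1)
  im-form = ℤ-Solver.solve-∀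
  im-even : ∀ p q → p * + 2 - q * + 4 ≡ + 0 + (+ 2 * (p - q * + 2) + + 0 * (q * + 2))
  im-even = ℤ-Solver.solve-∀
  r≡ : r ≡ + 1 + (+ 2 * (q * + 2) - + 0 * (p - q * + 2))
  r≡ = begin
    r                  ≡⟨ re-form r ⟩
    (r - + 1) + + 1    ≡⟨ cong (_+ + 1) r-1≡q*4 ⟩
    q * + 4 + + 1      ≡⟨ re-odd p q ⟩
    _                  ∎
  s≡ : s ≡ + 0 + (+ 2 * (p - q * + 2) + + 0 * (q * + 2))
  s≡ = begin
    s                           ≡⟨ im-form r s ⟩
    (r + s - + 1) - (r - + 1)   ≡⟨ cong₂ _-_ r+s-1≡p*2 r-1≡q*4 ⟩
    p * + 2 - q * + 4           ≡⟨ im-even p q ⟩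
    _                           ∎

Odd-⊗ : ∀ {x y} → Odd x → Odd y → Odd (x ⊗ y)
Odd-⊗ (u , refl) (v , refl) = u ⊕ v ⊕ 𝟚 ⊗ u ⊗ v , expand u v
  where
  expand : ∀ u v → (𝟙 ⊕ 𝟚 ⊗ u) ⊗ (𝟙 ⊕ 𝟚 ⊗ v) ≡ 𝟙 ⊕ 𝟚 ⊗ (u ⊕ v ⊕ 𝟚 ⊗ u ⊗ v)
  expand = solve-∀ ℤ[i]-ring

Odd-prod : ∀ {xs} → All Odd xs → Odd (prod xs)
Odd-prod [] = 𝟘 , refl
Odd-prod (odd ∷ odds) = Odd-⊗ odd (Odd-prod odds)

Odd-∣-cancel-𝟚 : ∀ {T d x} → Odd T → d ∣ T → d ∣ (𝟚 ⊗ x) → d ∣ x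
Odd-∣-cancel-𝟚 {d = d} {x} (u , refl) (v , T≡d⊗v) (w , 𝟚x≡d⊗w) = v ⊗ x ⊕ ⊖ (u ⊗ w) , (begin
  x                                   ≡⟨ odd-combination x u ⟩
  (𝟙 ⊕ 𝟚 ⊗ u) ⊗ x ⊕ ⊖ (u ⊗ (𝟚 ⊗ x))   ≡⟨ cong₂ (λ T 𝟚x → T ⊗ x ⊕ ⊖ (u ⊗ 𝟚x)) T≡d⊗v 𝟚x≡d⊗w ⟩
  d ⊗ v ⊗ x ⊕ ⊖ (u ⊗ (d ⊗ w))         ≡⟨ factor-out d v x u w ⟩
  d ⊗ (v ⊗ x ⊕ ⊖ (u ⊗ w))             ∎)
  where
  open ≡-Reasoning
  odd-combination : ∀ x u → x ≡ (𝟙 ⊕ 𝟚 ⊗ u) ⊗ x ⊕ ⊖ (u ⊗ (𝟚 ⊗ x))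
  odd-combination = solve-∀ ℤ[i]-ring
  factor-out : ∀ d v x u w → d ⊗ v ⊗ x ⊕ ⊖ (u ⊗ (d ⊗ w)) ≡ d ⊗ (v ⊗ x ⊕ ⊖ (u ⊗ w))
  factor-out = solve-∀ ℤ[i]-ring

_≟_ : (x y : ℤ[i]) → Dec (x ≡ y)
(a + b i) ≟ (c + d i) with a ℤₚ.≟ c | b ℤₚ.≟ d
... | yes refl | yes refl = yes refl
... | no a≢c   | _        = no λ { refl → a≢c refl }
... | yes _    | no b≢d   = no λ { refl → b≢d refl }

insert : ℤ[i] → List (ℤ[i] × ℕ) → List (ℤ[i] × ℕ)
insert x [] = (x , 1) ∷ []
insert x ((p , e) ∷ pes) with x ≟ p
... | yes _ = (p , suc e) ∷ pes
... | no _  = (p , e) ∷ insert x pes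

-- The power map is abstracted because the pattern lambda in ProdOfPowersOfDistinctOIPrimes
-- is not definitionally equal to any term we can write.
prod-insert : (pow : ℤ[i] × ℕ → ℤ[i]) → (∀ p e → pow (p , e) ≡ p ^ e) → ∀ x pes →
              prod (map pow (insert x pes)) ≡ x ⊗ prod (map pow pes)
prod-insert pow pow≗^ x [] = cong (_⊗ 𝟙) (trans (pow≗^ x 1) (⊗-identityʳ x))
prod-insert pow pow≗^ x ((p , e) ∷ pes) with x ≟ p
... | yes refl = begin
  pow (x , suc e) ⊗ rest     ≡⟨ cong (_⊗ rest) (pow≗^ x (suc e)) ⟩
  x ⊗ x ^ e ⊗ rest           ≡⟨ ⊗-assoc x (x ^ e) rest ⟩
  x ⊗ (x ^ e ⊗ rest)         ≡⟨ cong (λ y → x ⊗ (y ⊗ rest)) (pow≗^ x e) ⟨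
  x ⊗ (pow (x , e) ⊗ rest)   ∎
  where
  open ≡-Reasoning
  rest : ℤ[i]
  rest = prod (map pow pes)
... | no _ = begin
  pow (p , e) ⊗ prod (map pow (insert x pes))  ≡⟨ cong (pow (p , e) ⊗_) (prod-insert pow pow≗^ x pes) ⟩
  pow (p , e) ⊗ (x ⊗ prod (map pow pes))       ≡⟨ ⊗-left-comm (pow (p , e)) x (prod (map pow pes)) ⟩
  x ⊗ (pow (p , e) ⊗ prod (map pow pes))       ∎
  where open ≡-Reasoning

All-insert : ∀ {P : ℤ[i] → Set} {x} → P x → ∀ pes → All (λ pe → P (proj₁ pe)) pes →
             All (λ pe → P (proj₁ pe)) (insert x pes)
All-insert px [] [] = px ∷ []
All-insert {x = x} px ((p , e) ∷ pes) (pp ∷ ps) with x ≟ p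
... | yes _ = pp ∷ ps
... | no _  = pp ∷ All-insert px pes ps

AllPairs-≢-insert : ∀ x pes → AllPairs _≢_ (map proj₁ pes) → AllPairs _≢_ (map proj₁ (insert x pes))
AllPairs-≢-insert x [] [] = [] ∷ []
AllPairs-≢-insert x ((p , e) ∷ pes) (p∉pes ∷ distinct) with x ≟ p
... | yes _   = p∉pes ∷ distinct
... | no x≢p = All.map⁺ (All-insert (λ p≡x → x≢p (sym p≡x)) pes (All.map⁻ p∉pes)) ∷ AllPairs-≢-insert x pes distinct

collect-powers : ∀ {xs} → All OIPrime xs → ProdOfPowersOfDistinctOIPrimes (prod xs)
collect-powers [] = [] , [] , [] , refl
collect-powers {x ∷ xs} (px ∷ pxs) with pes , all-prime , distinct , xs≡ ← collect-powers pxs =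
  insert x pes , All-insert px pes all-prime , AllPairs-≢-insert x pes distinct ,
  trans (cong (x ⊗_) xs≡) (sym (prod-insert _ (λ _ _ → refl) x pes))

prod-interleaving : ∀ {xs ys zs} → Interleaving xs ys zs → prod zs ≡ prod xs ⊗ prod ys
prod-interleaving [] = refl
prod-interleaving {x ∷ xs} {ys} (consˡ split) =
  trans (cong (x ⊗_) (prod-interleaving split)) (sym (⊗-assoc x (prod xs) (prod ys)))
prod-interleaving {xs} {y ∷ ys} (consʳ split) =
  trans (cong (y ⊗_) (prod-interleaving split)) (⊗-left-comm y (prod xs) (prod ys))

All-interleaving : ∀ {P : ℤ[i] → Set} {xs ys zs} → Interleaving xs ys zs → All P zs → All P xs × All P ys
All-interleaving [] [] = [] , []
All-interleaving (consˡ split) (pz ∷ pzs) with pxs , pys ← All-interleaving split pzs = pz ∷ pxs , pys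
All-interleaving (consʳ split) (pz ∷ pzs) with pxs , pys ← All-interleaving split pzs = pxs , pz ∷ pys

peel-prime-square : ∀ {π A B C} → GaussianPrime π → π ∣ A → ¬ π ∣ B → A ⊗ B ≡ π ⊗ (π ⊗ C) →
                    ∃ λ A′ → A ≡ π ⊗ (π ⊗ A′) × A′ ⊗ B ≡ C
peel-prime-square {π} {B = B} {C} (π≢𝟘 , _ , π-prime) (A₁ , refl) π∤B πA₁B≡ππC =
  peel (π-prime A₁ B (C , A₁B≡πC))
  where
  A₁B≡πC : A₁ ⊗ B ≡ π ⊗ C
  A₁B≡πC = ⊗-cancelˡ π π≢𝟘 (trans (sym (⊗-assoc π A₁ B)) πA₁B≡ππC)
  peel : π ∣ A₁ ⊎ π ∣ B → ∃ λ A′ → π ⊗ A₁ ≡ π ⊗ (π ⊗ A′) × A′ ⊗ B ≡ C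
  peel (inj₁ (A′ , refl)) = A′ , refl , ⊗-cancelˡ π π≢𝟘 (trans (sym (⊗-assoc π A′ B)) A₁B≡πC)
  peel (inj₂ π∣B) = ⊥-elim (π∤B π∣B)

record SquareSplitting (c : ℤ[i]) (ps : List ℤ[i]) (A B : ℤ[i]) : Set where
  field
    {pl ql} : List ℤ[i]
    α β : ℤ[i]
    partition : Interleaving pl ql ps
    A≡α⊗P² : A ≡ α ⊗ (prod pl ⊗ prod pl)
    B≡β⊗Q² : B ≡ β ⊗ (prod ql ⊗ prod ql)
    α⊗β≡c : α ⊗ β ≡ c

SquareSplitting-swap : ∀ {c ps A B} → SquareSplitting c ps A B → SquareSplitting c ps B A
SquareSplitting-swap s = record
  { α = β ; β = α ; partition = swap partition
  ; A≡α⊗P² = B≡β⊗Q² ; B≡β⊗Q² = A≡α⊗P² ; α⊗β≡c = trans (⊗-comm β α) α⊗β≡c }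
  where open SquareSplitting s

SquareSplitting-∷ : ∀ {c π ps A A′ B} → A ≡ π ⊗ (π ⊗ A′) →
                    SquareSplitting c ps A′ B → SquareSplitting c (π ∷ ps) A B
SquareSplitting-∷ {π = π} refl s = record
  { α = α ; β = β ; partition = consˡ partition
  ; A≡α⊗P² = trans (cong (λ A′ → π ⊗ (π ⊗ A′)) A≡α⊗P²) (distribute π α (prod pl))
  ; B≡β⊗Q² = B≡β⊗Q² ; α⊗β≡c = α⊗β≡c }
  where
  open SquareSplitting s
  distribute : ∀ π α P → π ⊗ (π ⊗ (α ⊗ (P ⊗ P))) ≡ α ⊗ (π ⊗ P ⊗ (π ⊗ P))
  distribute = solve-∀ ℤ[i]-ring

-- Each π in ps divides A B but not both factors, so, being prime, π² divides one of them.
split-squares : ∀ c ps {A B} → All GaussianPrime ps → All (λ π → ¬ (π ∣ A × π ∣ B)) ps →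
                A ⊗ B ≡ c ⊗ (prod ps ⊗ prod ps) → SquareSplitting c ps A B
split-squares c [] {A} {B} [] [] AB≡c = record
  { α = A ; β = B ; partition = []
  ; A≡α⊗P² = sym (⊗-identityʳ A) ; B≡β⊗Q² = sym (⊗-identityʳ B) ; α⊗β≡c = trans AB≡c (⊗-identityʳ c) }
split-squares c (π ∷ ps) {A} {B} (π-prime@(_ , _ , π∣-split) ∷ primes) (π-not-both ∷ not-both) AB≡ =
  by-cases (π∣-split A B (π ⊗ (c ⊗ (P ⊗ P)) , AB≡ππcP²))
  where
  P : ℤ[i]
  P = prod ps
  AB≡ππcP² : A ⊗ B ≡ π ⊗ (π ⊗ (c ⊗ (P ⊗ P)))
  AB≡ππcP² = trans AB≡ (rearrange π c P)
    where
    rearrange : ∀ π c P → c ⊗ (π ⊗ P ⊗ (π ⊗ P)) ≡ π ⊗ (π ⊗ (c ⊗ (P ⊗ P)))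
    rearrange = solve-∀ ℤ[i]-ring
  ∣-quotient : ∀ {q X X′} → X ≡ π ⊗ (π ⊗ X′) → q ∣ X′ → q ∣ X
  ∣-quotient {q} {X′ = X′} refl q∣X′ = ∣y⇒∣x⊗y {q} π (∣y⇒∣x⊗y {q} π q∣X′)
  by-cases : π ∣ A ⊎ π ∣ B → SquareSplitting c (π ∷ ps) A B
  by-cases (inj₁ π∣A) =
    let A′ , A≡ππA′ , A′B≡cP² = peel-prime-square π-prime π∣A (λ π∣B → π-not-both (π∣A , π∣B)) AB≡ππcP² in
    SquareSplitting-∷ A≡ππA′ (split-squares c ps primes
      (All.map (λ {q} q-not-both (q∣A′ , q∣B) → q-not-both (∣-quotient {q} A≡ππA′ q∣A′ , q∣B)) not-both) A′B≡cP²)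
  by-cases (inj₂ π∣B) =
    let B′ , B≡ππB′ , B′A≡cP² = peel-prime-square π-prime π∣B (λ π∣A → π-not-both (π∣A , π∣B))
                                  (trans (⊗-comm B A) AB≡ππcP²) in
    SquareSplitting-swap (SquareSplitting-∷ B≡ππB′ (split-squares c ps primes
      (All.map (λ {q} q-not-both (q∣B′ , q∣A) → q-not-both (q∣A , ∣-quotient {q} B≡ππB′ q∣B′)) not-both) B′A≡cP²))

All-∣-prod : ∀ xs → All (_∣ prod xs) xs
All-∣-prod [] = []
All-∣-prod (x ∷ xs) = ∣x⇒∣x⊗y {x} (prod xs) (∣-refl x) ∷ All.map (λ {d} → ∣y⇒∣x⊗y {d} x) (All-∣-prod xs)

𝕚^-cofactor : ∀ t {β ε} → 𝕚 ^ t ⊗ β ≡ ⊖ ε → β ≡ 𝕚 ^ suc t ⊗ (ε ⊗ (⊖ 𝟙) ^ t ⊗ 𝕚)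
𝕚^-cofactor t {β} {ε} 𝕚^t⊗β≡-ε = begin
  β                            ≡⟨ ⊗-identityˡ β ⟨
  𝟙 ⊗ β                        ≡⟨ cong (_⊗ β) (𝕚^n⊗𝕚^n⊗[-1]^n≡𝟙 t) ⟨
  𝕚 ^ t ⊗ 𝕚 ^ t ⊗ m ⊗ β        ≡⟨ regroup (𝕚 ^ t) m β ⟩
  𝕚 ^ t ⊗ m ⊗ (𝕚 ^ t ⊗ β)      ≡⟨ cong (𝕚 ^ t ⊗ m ⊗_) 𝕚^t⊗β≡-ε ⟩
  𝕚 ^ t ⊗ m ⊗ ⊖ ε              ≡⟨ 𝕚²≡-1 (𝕚 ^ t) m ε ⟩
  𝕚 ⊗ 𝕚 ^ t ⊗ (ε ⊗ m ⊗ 𝕚)      ∎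
  where
  open ≡-Reasoning
  m : ℤ[i]
  m = (⊖ 𝟙) ^ t
  regroup : ∀ a m β → a ⊗ a ⊗ m ⊗ β ≡ a ⊗ m ⊗ (a ⊗ β)
  regroup = solve-∀ ℤ[i]-ring
  𝕚²≡-1 : ∀ a m ε → a ⊗ m ⊗ ⊖ ε ≡ 𝕚 ⊗ a ⊗ (ε ⊗ m ⊗ 𝕚)
  𝕚²≡-1 = solve-∀ ℤ[i]-ring

1-i : ℤ[i]
1-i = (+ 1) + -[1+ 0 ] i

∣[1+i]x⇒∣𝟚x : ∀ {d} x → d ∣ (1+i ⊗ x) → d ∣ (𝟚 ⊗ x)
∣[1+i]x⇒∣𝟚x {d} x d∣[1+i]x = subst (d ∣_) (sym (𝟚≡[1-i][1+i] x)) (∣y⇒∣x⊗y {d} 1-i d∣[1+i]x)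
  where
  𝟚≡[1-i][1+i] : ∀ x → 𝟚 ⊗ x ≡ 1-i ⊗ (1+i ⊗ x)
  𝟚≡[1-i][1+i] = solve-∀ ℤ[i]-ring

module OddPair (U V : ℤ[i]) where

  X Z A B : ℤ[i]
  X = 𝟙 ⊕ 𝟚 ⊗ U
  Z = 𝟙 ⊕ 𝟚 ⊗ V
  A = 𝟙 ⊕ 1-i ⊗ (U ⊕ 𝕚 ⊗ V)
  B = 𝟙 ⊕ 1+i ⊗ (U ⊕ ⊖ (𝕚 ⊗ V))

  [1+i]X≡𝕚A+B : 1+i ⊗ X ≡ 𝕚 ⊗ A ⊕ B
  [1+i]X≡𝕚A+B = identity U V
    where
    identity : ∀ U V → 1+i ⊗ (𝟙 ⊕ 𝟚 ⊗ U) ≡ 𝕚 ⊗ (𝟙 ⊕ 1-i ⊗ (U ⊕ 𝕚 ⊗ V)) ⊕ (𝟙 ⊕ 1+i ⊗ (U ⊕ ⊖ (𝕚 ⊗ V)))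
    identity = solve-∀ ℤ[i]-ring

  [1+i]Z≡A+𝕚B : 1+i ⊗ Z ≡ A ⊕ 𝕚 ⊗ B
  [1+i]Z≡A+𝕚B = identity U V
    where
    identity : ∀ U V → 1+i ⊗ (𝟙 ⊕ 𝟚 ⊗ V) ≡ (𝟙 ⊕ 1-i ⊗ (U ⊕ 𝕚 ⊗ V)) ⊕ 𝕚 ⊗ (𝟙 ⊕ 1+i ⊗ (U ⊕ ⊖ (𝕚 ⊗ V)))
    identity = solve-∀ ℤ[i]-ring

  𝟚AB≡X²+Z² : 𝟚 ⊗ (A ⊗ B) ≡ X ^ 2 ⊕ Z ^ 2
  𝟚AB≡X²+Z² = identity U V
    where
    identity : ∀ U V → 𝟚 ⊗ ((𝟙 ⊕ 1-i ⊗ (U ⊕ 𝕚 ⊗ V)) ⊗ (𝟙 ⊕ 1+i ⊗ (U ⊕ ⊖ (𝕚 ⊗ V))))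
                       ≡ (𝟙 ⊕ 𝟚 ⊗ U) ⊗ ((𝟙 ⊕ 𝟚 ⊗ U) ⊗ 𝟙) ⊕ (𝟙 ⊕ 𝟚 ⊗ V) ⊗ ((𝟙 ⊕ 𝟚 ⊗ V) ⊗ 𝟙)
    identity = solve-∀ ℤ[i]-ring

  A⊗B≡-εW² : ∀ ε W → X ^ 2 ⊕ Z ^ 2 ≡ ε ⊗ 𝕚 ⊗ (1+i ⊗ W) ^ 2 → A ⊗ B ≡ ⊖ ε ⊗ (W ⊗ W)
  A⊗B≡-εW² ε W X²+Z²≡ = ⊗-cancelˡ 𝟚 (λ ()) (begin
    𝟚 ⊗ (A ⊗ B)                  ≡⟨ 𝟚AB≡X²+Z² ⟩
    X ^ 2 ⊕ Z ^ 2                ≡⟨ X²+Z²≡ ⟩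
    ε ⊗ 𝕚 ⊗ (1+i ⊗ W) ^ 2        ≡⟨ [1+i]²≡2𝕚 ε W ⟩
    𝟚 ⊗ (⊖ ε ⊗ (W ⊗ W))          ∎)
    where
    open ≡-Reasoning
    [1+i]²≡2𝕚 : ∀ ε W → ε ⊗ 𝕚 ⊗ (1+i ⊗ W ⊗ (1+i ⊗ W ⊗ 𝟙)) ≡ 𝟚 ⊗ (⊖ ε ⊗ (W ⊗ W))
    [1+i]²≡2𝕚 = solve-∀ ℤ[i]-ring

  odd-common-divisor⇒IsUnit : ∀ {Y T d} → CoprimeTo3 X Y Z → Odd T →
                              d ∣ T → d ∣ A → d ∣ B → d ∣ Y → IsUnit d
  odd-common-divisor⇒IsUnit {d = d} coprime odd d∣T d∣A d∣B d∣Y =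
    coprime d (Odd-∣-cancel-𝟚 {d = d} {X} odd d∣T (∣[1+i]x⇒∣𝟚x {d} X d∣[1+i]X)) d∣Y
              (Odd-∣-cancel-𝟚 {d = d} {Z} odd d∣T (∣[1+i]x⇒∣𝟚x {d} Z d∣[1+i]Z))
    where
    d∣[1+i]X : d ∣ (1+i ⊗ X)
    d∣[1+i]X = subst (d ∣_) (sym [1+i]X≡𝕚A+B) (∣x∣y⇒∣x⊕y {d} (∣y⇒∣x⊗y {d} 𝕚 d∣A) d∣B)
    d∣[1+i]Z : d ∣ (1+i ⊗ Z)
    d∣[1+i]Z = subst (d ∣_) (sym [1+i]Z≡A+𝕚B) (∣x∣y⇒∣x⊕y {d} d∣A (∣y⇒∣x⊗y {d} 𝕚 d∣B))

  no-shared-prime : ∀ {ps} → CoprimeTo3 X (1+i ⊗ prod ps) Z → All OIPrime ps →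
                    All (λ π → ¬ (π ∣ A × π ∣ B)) ps
  no-shared-prime {ps} coprime oi-primes = All.zipWith no-shared (oi-primes , All-∣-prod ps)
    where
    no-shared : ∀ {π} → OIPrime π × π ∣ prod ps → ¬ (π ∣ A × π ∣ B)
    no-shared {π} (((_ , non-unit , _) , oi) , π∣W) (π∣A , π∣B) =
      non-unit (odd-common-divisor⇒IsUnit coprime (OI⇒Odd oi) (∣-refl π) π∣A π∣B (∣y⇒∣x⊗y {π} 1+i π∣W))

  Coprime-square-roots : ∀ {P Q α β} → CoprimeTo3 X (1+i ⊗ (P ⊗ Q)) Z → Odd P →
                         A ≡ α ⊗ (P ⊗ P) → B ≡ β ⊗ (Q ⊗ Q) → Coprime P Q
  Coprime-square-roots {P} {Q} {α} {β} coprime odd A≡ B≡ d d∣P d∣Q =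
    odd-common-divisor⇒IsUnit coprime odd d∣P
      (subst (d ∣_) (sym A≡) (∣y⇒∣x⊗y {d} α (∣x⇒∣x⊗y {d} P d∣P)))
      (subst (d ∣_) (sym B≡) (∣y⇒∣x⊗y {d} β (∣x⇒∣x⊗y {d} Q d∣Q)))
      (∣y⇒∣x⊗y {d} 1+i (∣x⇒∣x⊗y {d} Q d∣P))

  [1+i]X≡ : ∀ t {ε P Q} → A ≡ 𝕚 ^ t ⊗ (P ⊗ P) → B ≡ 𝕚 ^ suc t ⊗ (ε ⊗ (⊖ 𝟙) ^ t ⊗ 𝕚) ⊗ (Q ⊗ Q) →
            1+i ⊗ X ≡ 𝕚 ^ suc t ⊗ (P ^ 2 ⊕ ε ⊗ (⊖ 𝟙) ^ t ⊗ 𝕚 ⊗ Q ^ 2)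
  [1+i]X≡ t {ε} {P} {Q} A≡ B≡ = begin
    1+i ⊗ X                                                   ≡⟨ [1+i]X≡𝕚A+B ⟩
    𝕚 ⊗ A ⊕ B                                                 ≡⟨ cong₂ (λ A B → 𝕚 ⊗ A ⊕ B) A≡ B≡ ⟩
    𝕚 ⊗ (𝕚 ^ t ⊗ (P ⊗ P)) ⊕ 𝕚 ^ suc t ⊗ (ε ⊗ m ⊗ 𝕚) ⊗ (Q ⊗ Q) ≡⟨ factor (𝕚 ^ t) ε m P Q ⟩
    𝕚 ^ suc t ⊗ (P ^ 2 ⊕ ε ⊗ m ⊗ 𝕚 ⊗ Q ^ 2)                   ∎
    where
    open ≡-Reasoning
    m : ℤ[i]
    m = (⊖ 𝟙) ^ t
    factor : ∀ a ε m P Q → 𝕚 ⊗ (a ⊗ (P ⊗ P)) ⊕ 𝕚 ⊗ a ⊗ (ε ⊗ m ⊗ 𝕚) ⊗ (Q ⊗ Q)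
                           ≡ 𝕚 ⊗ a ⊗ (P ⊗ (P ⊗ 𝟙) ⊕ ε ⊗ m ⊗ 𝕚 ⊗ (Q ⊗ (Q ⊗ 𝟙)))
    factor = solve-∀ ℤ[i]-ring

  [1+i]Z≡ : ∀ t {ε P Q} → A ≡ 𝕚 ^ t ⊗ (P ⊗ P) → B ≡ 𝕚 ^ suc t ⊗ (ε ⊗ (⊖ 𝟙) ^ t ⊗ 𝕚) ⊗ (Q ⊗ Q) →
            1+i ⊗ Z ≡ 𝕚 ^ t ⊗ (P ^ 2 ⊕ ⊖ (ε ⊗ (⊖ 𝟙) ^ t ⊗ 𝕚 ⊗ Q ^ 2))
  [1+i]Z≡ t {ε} {P} {Q} A≡ B≡ = begin
    1+i ⊗ Z                                                   ≡⟨ [1+i]Z≡A+𝕚B ⟩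
    A ⊕ 𝕚 ⊗ B                                                 ≡⟨ cong₂ (λ A B → A ⊕ 𝕚 ⊗ B) A≡ B≡ ⟩
    𝕚 ^ t ⊗ (P ⊗ P) ⊕ 𝕚 ⊗ (𝕚 ^ suc t ⊗ (ε ⊗ m ⊗ 𝕚) ⊗ (Q ⊗ Q)) ≡⟨ factor (𝕚 ^ t) ε m P Q ⟩
    𝕚 ^ t ⊗ (P ^ 2 ⊕ ⊖ (ε ⊗ m ⊗ 𝕚 ⊗ Q ^ 2))                   ∎
    where
    open ≡-Reasoning
    m : ℤ[i]
    m = (⊖ 𝟙) ^ t
    factor : ∀ a ε m P Q → a ⊗ (P ⊗ P) ⊕ 𝕚 ⊗ (𝕚 ⊗ a ⊗ (ε ⊗ m ⊗ 𝕚) ⊗ (Q ⊗ Q))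
                           ≡ a ⊗ (P ⊗ (P ⊗ 𝟙) ⊕ ⊖ (ε ⊗ m ⊗ 𝕚 ⊗ (Q ⊗ (Q ⊗ 𝟙))))
    factor = solve-∀ ℤ[i]-ring

  parametrisation : ∀ ε ps → IsUnit ε → All OIPrime ps →
    X ^ 2 ⊕ Z ^ 2 ≡ ε ⊗ 𝕚 ⊗ (1+i ⊗ prod ps) ^ 2 → CoprimeTo3 X (1+i ⊗ prod ps) Z →
    Σ ℕ λ t → t ≤ 3 × Σ ℤ[i] λ P → Σ ℤ[i] λ Q →
      ProdOfPowersOfDistinctOIPrimes P × ProdOfPowersOfDistinctOIPrimes Q ×
      Coprime P Q ×
      1+i ⊗ X ≡ 𝕚 ^ suc t ⊗ (P ^ 2 ⊕ ε ⊗ (⊖ 𝟙) ^ t ⊗ 𝕚 ⊗ Q ^ 2) ×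
      1+i ⊗ Z ≡ 𝕚 ^ t ⊗ (P ^ 2 ⊕ ⊖ (ε ⊗ (⊖ 𝟙) ^ t ⊗ 𝕚 ⊗ Q ^ 2)) ×
      1+i ⊗ prod ps ≡ 1+i ⊗ P ⊗ Q
  parametrisation ε ps ε-unit oi-primes X²+Z²≡ coprime =
    t , t≤3 , prod pl , prod ql , collect-powers oi-pl , collect-powers oi-ql ,
    Coprime-square-roots {prod pl} {prod ql} {α} {β}
      (subst (λ W → CoprimeTo3 X (1+i ⊗ W) Z) W≡PQ coprime)
      (Odd-prod (All.map (OI⇒Odd ∘ proj₂) oi-pl)) A≡α⊗P² B≡β⊗Q² ,
    [1+i]X≡ t {ε} {prod pl} {prod ql} A≡𝕚^tP² B≡cofactorQ² ,
    [1+i]Z≡ t {ε} {prod pl} {prod ql} A≡𝕚^tP² B≡cofactorQ² ,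
    trans (cong (1+i ⊗_) W≡PQ) (sym (⊗-assoc 1+i (prod pl) (prod ql)))
    where
    splitting : SquareSplitting (⊖ ε) ps A B
    splitting = split-squares (⊖ ε) ps (All.map proj₁ oi-primes) (no-shared-prime coprime oi-primes)
                              (A⊗B≡-εW² ε (prod ps) X²+Z²≡)
    open SquareSplitting splitting
    W≡PQ : prod ps ≡ prod pl ⊗ prod ql
    W≡PQ = prod-interleaving partition
    oi-pl : All OIPrime pl
    oi-pl = proj₁ (All-interleaving partition oi-primes)
    oi-ql : All OIPrime ql
    oi-ql = proj₂ (All-interleaving partition oi-primes)
    α-power : Σ ℕ λ t → t ≤ 3 × α ≡ 𝕚 ^ t
    α-power = IsUnit⇒≡𝕚^ (IsUnit-factor α⊗β≡c (IsUnit-⊖ ε-unit))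
    t : ℕ
    t = proj₁ α-power
    t≤3 : t ≤ 3
    t≤3 = proj₁ (proj₂ α-power)
    α≡𝕚^t : α ≡ 𝕚 ^ t
    α≡𝕚^t = proj₂ (proj₂ α-power)
    A≡𝕚^tP² : A ≡ 𝕚 ^ t ⊗ (prod pl ⊗ prod pl)
    A≡𝕚^tP² = trans A≡α⊗P² (cong (_⊗ (prod pl ⊗ prod pl)) α≡𝕚^t)
    B≡cofactorQ² : B ≡ 𝕚 ^ suc t ⊗ (ε ⊗ (⊖ 𝟙) ^ t ⊗ 𝕚) ⊗ (prod ql ⊗ prod ql)
    B≡cofactorQ² = trans B≡β⊗Q² (cong (_⊗ (prod ql ⊗ prod ql))
                     (𝕚^-cofactor t (trans (cong (_⊗ β) (sym α≡𝕚^t)) α⊗β≡c)))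

theorem4p10 : (ε X Y Z W : ℤ[i]) →
    (ε ≡ 𝟙 ⊎ ε ≡ ⊖ 𝟙) →
    OI X → OI Z →
    Y ≡ 1+i ⊗ W → ProdOfOIPrimes W →
    X ^ 2 ⊕ Z ^ 2 ≡ ε ⊗ 𝕚 ⊗ Y ^ 2 →
    CoprimeTo3 X Y Z →
    X ⊗ Y ⊗ Z ≢ 𝟘 →
    Σ ℕ λ t → t ≤ 3 × Σ ℤ[i] λ P → Σ ℤ[i] λ Q →
      ProdOfPowersOfDistinctOIPrimes P × ProdOfPowersOfDistinctOIPrimes Q ×
      Coprime P Q ×
      1+i ⊗ X ≡ 𝕚 ^ suc t ⊗ (P ^ 2 ⊕ ε ⊗ (⊖ 𝟙) ^ t ⊗ 𝕚 ⊗ Q ^ 2) ×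
      1+i ⊗ Z ≡ 𝕚 ^ t ⊗ (P ^ 2 ⊕ ⊖ (ε ⊗ (⊖ 𝟙) ^ t ⊗ 𝕚 ⊗ Q ^ 2)) ×
      Y ≡ 1+i ⊗ P ⊗ Q
theorem4p10 ε X Y Z W ε≡±1 oi-X oi-Z refl (ps , oi-primes , refl) X²+Z²≡ coprime _
  with U , refl ← OI⇒Odd {X} oi-X | V , refl ← OI⇒Odd {Z} oi-Z =
  OddPair.parametrisation U V ε ps (Sum.map₂ inj₁ ε≡±1) oi-primes X²+Z²≡ coprime
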